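{- Let $n,l,t,s$ be integers with $l\ge0$ and $n/2-l-t$ a nonnegative integer, and let $m$ be an integer with $n\ge m>4(s+2l+t)^2$ such that a Hadamard matrix of size $m$ exists. Then \[ \chi\left[K\left(n,\tfrac n2-l-t,l,-2l+s\right)\right]\le 2m. \]
   Context: For integers $n,k,l$ let $V_{k,l}$ be the set of vectors $v\in\{0,1,-1\}^n$ having exactly $k$ coordinates equal to $1$ and exactly $l$ coordinates equal to $-1$. For a real $\sigma$, $K(n,k,l,\sigma)$ is the graph with vertex set $V_{k,l}$ in which two vectors $v_1,v_2$ are adjacent iff their standard scalar product satisfies $(v_1,v_2)<\sigma$. $\chi$ denotes the chromatic number. A Hadamard matrix of size $m$ is an $m\times m$ matrix with entries $\pm1$ whose rows are mutually orthogonal. -}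

module Defs where

open import Data.Nat as ℕ using (ℕ; zero; suc)
open import Data.Integer as ℤ using (ℤ; +_; -_; _<_)
open import Data.Fin using (Fin; zero; suc)
open import Data.Product using (Σ; _×_; _,_; proj₁)
open import Data.Sum using (_⊎_)
open import Relation.Binary.PropositionalEquality using (_≡_; _≢_)
open import Relation.Nullary using (¬_; yes; no)

sumℤ : ∀ {n} → (Fin n → ℤ) → ℤ
sumℤ {zero}  f = + 0
sumℤ {suc n} f = f zero ℤ.+ sumℤ (λ i → f (suc i))

dot : ∀ {n} → (Fin n → ℤ) → (Fin n → ℤ) → ℤ
dot u v = sumℤ (λ i → u i ℤ.* v i)

countEq : ∀ {n} → ℤ → (Fin n → ℤ) → ℕ
countEq {zero}  a v = 0
countEq {suc n} a v with v zero ℤ.≟ a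
... | yes _ = suc (countEq a (λ i → v (suc i)))
... | no  _ = countEq a (λ i → v (suc i))

Ternary : ∀ {n} → (Fin n → ℤ) → Set
Ternary v = ∀ i → (v i ≡ + 0) ⊎ ((v i ≡ + 1) ⊎ (v i ≡ - (+ 1)))

V : (n k l : ℕ) → Set
V n k l = Σ (Fin n → ℤ) λ v → Ternary v × (countEq (+ 1) v ≡ k × countEq (- (+ 1)) v ≡ l)

vec : ∀ {n k l} → V n k l → Fin n → ℤ
vec = proj₁

-- adjacency in K(n,k,l,σ) (σ an integer here): distinct vertices with (v₁,v₂) < σ
Adj : ∀ {n k l} → ℤ → V n k l → V n k l → Set
Adj σ v w = ¬ (∀ i → vec v i ≡ vec w i) × (dot (vec v) (vec w) < σ)

-- χ[K(n,k,l,σ)] ≤ r : there is a proper colouring with r colours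
χ≤ : (n k l : ℕ) → ℤ → ℕ → Set
χ≤ n k l σ r = Σ (V n k l → Fin r) λ c → ∀ v w → Adj σ v w → c v ≢ c w

IsHadamard : (m : ℕ) → (Fin m → Fin m → ℤ) → Set
IsHadamard m H = (∀ i j → (H i j ≡ + 1) ⊎ (H i j ≡ - (+ 1)))
               × (∀ i j → i ≢ j → dot (H i) (H j) ≡ + 0)

HadamardExists : ℕ → Set
HadamardExists m = Σ (Fin m → Fin m → ℤ) (IsHadamard m)

-- Write n = M + r with M the order of a Hadamard matrix H, and attach to a vertex v the ±1 vector u
-- of its first M coordinates (u_j = 1 iff v_j = 1). Since the rows of H are orthogonal,
-- Σ_k (Hᵀu)_k² = M |u|² = M², so some k has (Hᵀu)_k² ≥ M; colour v by such a k and the sign ε of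
-- (Hᵀu)_k, which uses 2M colours. If v and w share the colour (k, ε), both ε(Hᵀu)_k and ε(Hᵀu′)_k
-- are at least √M, while their sum is at most S = Σ_{j<M} (1 + u_j u′_j); hence 4M ≤ S².
-- Extending S to all n coordinates and counting the 1s and -1s of v and w bounds it by
-- 2(n + 2(2l - k)) + 4(v, w) ≤ 4(s + 2l + t) when (v, w) < -2l + s, so 4M ≤ 16(s + 2l + t)² < 4M.
module Submission where

open import Defs
open import Data.Nat using (ℕ)
open import Data.Integer using (ℤ; +_; -_; _+_; _*_; _<_; _≤_)
open import Relation.Binary.PropositionalEquality using (_≡_)

import Data.Nat as ℕ
open import Data.Nat using (zero; suc)
import Data.Nat.Properties as ℕ
open import Data.Integer using (0ℤ; 1ℤ; -1ℤ; -[1+_]; +≤+; _-_; nonNegative)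
import Data.Integer.Properties as ℤ
open import Data.Integer.Tactic.RingSolver using (solve-∀)
open import Data.Fin using (Fin; zero; suc; _↑ˡ_; combine)
import Data.Fin.Properties as Fin
open import Data.Product using (Σ; _×_; _,_; proj₁; proj₂)
open import Data.Sum using (_⊎_; inj₁; inj₂)
open import Data.Empty using (⊥-elim)
open import Function using (_∘_)
open import Relation.Nullary using (yes; no)
open import Relation.Nullary.Decidable using (True; toWitness)
open import Relation.Binary.PropositionalEquality
  using (refl; sym; trans; cong; cong₂; subst; subst₂; _≢_; module ≡-Reasoning)
open import Algebra.Properties.Semiring.Sum ℤ.+-*-semiring
  using ( sum; sum-syntax; sum-cong-≗; sum-replicate-zero; ∑-distrib-+; ∑-comm
        ; *-distribˡ-sum; *-distribʳ-sum)

decide-≤ : ∀ {a b} {a≤b : True (a ℤ.≤? b)} → a ≤ b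
decide-≤ {a≤b = a≤b} = toWitness a≤b

≤-from-difference : ∀ {a b} d → 0ℤ ≤ d → b ≡ a + d → a ≤ b
≤-from-difference {a} d 0≤d b≡a+d = subst (a ≤_) (sym b≡a+d) (ℤ.i≤i+j a d {{nonNegative 0≤d}})

square-nonNeg : ∀ x → 0ℤ ≤ x * x
square-nonNeg (+ zero)   = +≤+ ℕ.z≤n
square-nonNeg (+ suc n)  = +≤+ ℕ.z≤n
square-nonNeg -[1+ n ]   = +≤+ ℕ.z≤n

square-mono-≤ : ∀ {x y} → 0ℤ ≤ x → x ≤ y → x * x ≤ y * y
square-mono-≤ {x} {y} 0≤x x≤y = ℤ.≤-trans
  (ℤ.*-monoˡ-≤-nonNeg x {{nonNegative 0≤x}} x≤y)
  (ℤ.*-monoʳ-≤-nonNeg y {{nonNegative (ℤ.≤-trans 0≤x x≤y)}} x≤y)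

double-square-bound : ∀ {c z S} → 0ℤ ≤ z → c ≤ z * z → z + z ≤ S → + 4 * c ≤ S * S
double-square-bound {c} {z} {S} 0≤z c≤z² z+z≤S = begin
  + 4 * c             ≤⟨ ℤ.*-monoˡ-≤-nonNeg (+ 4) c≤z² ⟩
  + 4 * (z * z)       ≡⟨ four-squares z ⟩
  (z + z) * (z + z)   ≤⟨ square-mono-≤ (ℤ.+-mono-≤ 0≤z 0≤z) z+z≤S ⟩
  S * S               ∎
  where
  open ℤ.≤-Reasoning
  four-squares : ∀ z → + 4 * (z * z) ≡ (z + z) * (z + z)
  four-squares = solve-∀

min-square-bound : ∀ {c x y S} → 0ℤ ≤ x → 0ℤ ≤ y → c ≤ x * x → c ≤ y * y → x + y ≤ S →
                   + 4 * c ≤ S * S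
min-square-bound {x = x} {y} 0≤x 0≤y c≤x² c≤y² x+y≤S with ℤ.≤-total x y
... | inj₁ x≤y = double-square-bound 0≤x c≤x² (ℤ.≤-trans (ℤ.+-monoʳ-≤ x x≤y) x+y≤S)
... | inj₂ y≤x = double-square-bound 0≤y c≤y² (ℤ.≤-trans (ℤ.+-monoˡ-≤ y y≤x) x+y≤S)

sumℤ≡sum : ∀ {n} (f : Fin n → ℤ) → sumℤ f ≡ sum f
sumℤ≡sum {zero}  f = refl
sumℤ≡sum {suc n} f = cong (λ x → f zero + x) (sumℤ≡sum (f ∘ suc))

sum-const : ∀ n (c : ℤ) → ∑[ i < n ] c ≡ + n * c
sum-const zero    c = refl
sum-const (suc n) c = trans (cong (λ x → c + x) (sum-const n c)) (distrib c (+ n))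
  where
  distrib : ∀ c x → c + x * c ≡ (1ℤ + x) * c
  distrib = solve-∀

sum-mono-≤ : ∀ {n} {f g : Fin n → ℤ} → (∀ i → f i ≤ g i) → sum f ≤ sum g
sum-mono-≤ {zero}  f≤g = ℤ.≤-refl
sum-mono-≤ {suc n} f≤g = ℤ.+-mono-≤ (f≤g zero) (sum-mono-≤ (f≤g ∘ suc))

sum-nonNeg : ∀ {n} {f : Fin n → ℤ} → (∀ i → 0ℤ ≤ f i) → 0ℤ ≤ sum f
sum-nonNeg {n} {f} f≥0 = subst (_≤ sum f) (sum-replicate-zero n) (sum-mono-≤ f≥0)

sum-↑ˡ-≤ : ∀ m {r} {f : Fin (m ℕ.+ r) → ℤ} → (∀ i → 0ℤ ≤ f i) → sum (f ∘ (_↑ˡ r)) ≤ sum f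
sum-↑ˡ-≤ zero    f≥0 = sum-nonNeg f≥0
sum-↑ˡ-≤ (suc m) {f = f} f≥0 = ℤ.+-monoʳ-≤ (f zero) (sum-↑ˡ-≤ m (f≥0 ∘ suc))

sum-single : ∀ {n} (g : Fin n → ℤ) i → (∀ j → j ≢ i → g j ≡ 0ℤ) → sum g ≡ g i
sum-single {suc n} g zero    g≡0 = trans (cong (λ x → g zero + x) rest≡0) (ℤ.+-identityʳ (g zero))
  where
  rest≡0 : ∑[ j < n ] g (suc j) ≡ 0ℤ
  rest≡0 = trans (sum-cong-≗ (λ j → g≡0 (suc j) λ ())) (sum-replicate-zero n)
sum-single {suc n} g (suc i) g≡0 = trans (cong₂ _+_ (g≡0 zero λ ()) rest≡gi) (ℤ.+-identityˡ _)
  where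
  rest≡gi : ∑[ j < n ] g (suc j) ≡ g (suc i)
  rest≡gi = sum-single (g ∘ suc) i (λ j j≢i → g≡0 (suc j) (j≢i ∘ Fin.suc-injective))

argmax : ∀ {n} (g : Fin (suc n) → ℤ) → Σ (Fin (suc n)) λ i → ∀ j → g j ≤ g i
argmax {zero}  g = zero , λ { zero → ℤ.≤-refl }
argmax {suc n} g with argmax (g ∘ suc)
... | i , max with g zero ℤ.≤? g (suc i)
...   | yes g₀≤ = suc i , λ { zero → g₀≤ ; (suc j) → max j }
...   | no  g₀≰ = zero , λ { zero → ℤ.≤-refl ; (suc j) → ℤ.≤-trans (max j) (ℤ.<⇒≤ (ℤ.≰⇒> g₀≰)) }

IsUnit : ℤ → Set
IsUnit x = x ≡ 1ℤ ⊎ x ≡ -1ℤ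

unit-square : ∀ {x} → IsUnit x → x * x ≡ 1ℤ
unit-square (inj₁ refl) = refl
unit-square (inj₂ refl) = refl

unit-* : ∀ {a b} → IsUnit a → IsUnit b → IsUnit (a * b)
unit-* (inj₁ refl) (inj₁ refl) = inj₁ refl
unit-* (inj₁ refl) (inj₂ refl) = inj₂ refl
unit-* (inj₂ refl) (inj₁ refl) = inj₂ refl
unit-* (inj₂ refl) (inj₂ refl) = inj₁ refl

unit-*-square : ∀ {e} a → IsUnit e → (e * a) * (e * a) ≡ a * a
unit-*-square a (inj₁ refl) = cong₂ _*_ (ℤ.*-identityˡ a) (ℤ.*-identityˡ a)
unit-*-square a (inj₂ refl) = negate² a
  where
  negate² : ∀ a → (-1ℤ * a) * (-1ℤ * a) ≡ a * a
  negate² = solve-∀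

-- e * (u + w) is ±2 when u = w and 0 otherwise.
unit-pair-bound : ∀ {e u w} → IsUnit e → IsUnit u → IsUnit w → e * (u + w) ≤ 1ℤ + u * w
unit-pair-bound (inj₁ refl) (inj₁ refl) (inj₁ refl) = decide-≤
unit-pair-bound (inj₁ refl) (inj₁ refl) (inj₂ refl) = decide-≤
unit-pair-bound (inj₁ refl) (inj₂ refl) (inj₁ refl) = decide-≤
unit-pair-bound (inj₁ refl) (inj₂ refl) (inj₂ refl) = decide-≤
unit-pair-bound (inj₂ refl) (inj₁ refl) (inj₁ refl) = decide-≤
unit-pair-bound (inj₂ refl) (inj₁ refl) (inj₂ refl) = decide-≤
unit-pair-bound (inj₂ refl) (inj₂ refl) (inj₁ refl) = decide-≤
unit-pair-bound (inj₂ refl) (inj₂ refl) (inj₂ refl) = decide-≤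

unit-agreement-nonNeg : ∀ {u w} → IsUnit u → IsUnit w → 0ℤ ≤ 1ℤ + u * w
unit-agreement-nonNeg (inj₁ refl) (inj₁ refl) = decide-≤
unit-agreement-nonNeg (inj₁ refl) (inj₂ refl) = decide-≤
unit-agreement-nonNeg (inj₂ refl) (inj₁ refl) = decide-≤
unit-agreement-nonNeg (inj₂ refl) (inj₂ refl) = decide-≤

sum-square-units : ∀ {n} {u : Fin n → ℤ} → (∀ i → IsUnit (u i)) → ∑[ i < n ] (u i * u i) ≡ + n
sum-square-units {n} u±1 =
  trans (sum-cong-≗ (unit-square ∘ u±1)) (trans (sum-const n 1ℤ) (ℤ.*-identityʳ (+ n)))

unit-inner-products-bound : ∀ {n e} {h u w : Fin n → ℤ} →
  IsUnit e → (∀ j → IsUnit (h j)) → (∀ j → IsUnit (u j)) → (∀ j → IsUnit (w j)) →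
  e * ∑[ j < n ] (u j * h j) + e * ∑[ j < n ] (w j * h j) ≤ ∑[ j < n ] (1ℤ + u j * w j)
unit-inner-products-bound {n} {e} {h} {u} {w} e±1 h±1 u±1 w±1 = begin
  e * ∑[ j < n ] (u j * h j) + e * ∑[ j < n ] (w j * h j)
    ≡⟨ cong₂ _+_ (*-distribˡ-sum e (λ j → u j * h j)) (*-distribˡ-sum e (λ j → w j * h j)) ⟩
  ∑[ j < n ] (e * (u j * h j)) + ∑[ j < n ] (e * (w j * h j))
    ≡⟨ ∑-distrib-+ (λ j → e * (u j * h j)) (λ j → e * (w j * h j)) ⟨
  ∑[ j < n ] (e * (u j * h j) + e * (w j * h j))
    ≡⟨ sum-cong-≗ (λ j → factor e (u j) (w j) (h j)) ⟩
  ∑[ j < n ] ((e * h j) * (u j + w j))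
    ≤⟨ sum-mono-≤ (λ j → unit-pair-bound (unit-* e±1 (h±1 j)) (u±1 j) (w±1 j)) ⟩
  ∑[ j < n ] (1ℤ + u j * w j) ∎
  where
  open ℤ.≤-Reasoning
  factor : ∀ e u w h → e * (u * h) + e * (w * h) ≡ (e * h) * (u + w)
  factor = solve-∀

signOf : Fin 2 → ℤ
signOf zero    = 1ℤ
signOf (suc _) = -1ℤ

signOf-unit : ∀ ε → IsUnit (signOf ε)
signOf-unit zero    = inj₁ refl
signOf-unit (suc _) = inj₂ refl

signIndex : ℤ → Fin 2
signIndex x with 0ℤ ℤ.≤? x
... | yes _ = zero
... | no  _ = suc zero

signIndex-nonNeg : ∀ x → 0ℤ ≤ signOf (signIndex x) * x
signIndex-nonNeg x with 0ℤ ℤ.≤? x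
... | yes 0≤x = subst (0ℤ ≤_) (sym (ℤ.*-identityˡ x)) 0≤x
... | no  0≰x = subst (0ℤ ≤_) (sym (ℤ.-1*i≡-i x)) (ℤ.neg-mono-≤ (ℤ.<⇒≤ (ℤ.≰⇒> 0≰x)))

_ᵀ·_ : ∀ {m n} → (Fin m → Fin n → ℤ) → (Fin m → ℤ) → Fin n → ℤ
_ᵀ·_ {m} A u k = ∑[ i < m ] (u i * A i k)

∑-ᵀ·-square : ∀ {m n} (A : Fin m → Fin n → ℤ) (u : Fin m → ℤ) →
  ∑[ k < n ] ((A ᵀ· u) k * (A ᵀ· u) k) ≡ ∑[ i < m ] ∑[ i′ < m ] ((u i * u i′) * dot (A i) (A i′))
∑-ᵀ·-square {m} {n} A u = begin
  ∑[ k < n ] ((A ᵀ· u) k * (A ᵀ· u) k)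
    ≡⟨ sum-cong-≗ (λ k → *-distribʳ-sum ((A ᵀ· u) k) (λ i → u i * A i k)) ⟩
  ∑[ k < n ] ∑[ i < m ] ((u i * A i k) * (A ᵀ· u) k)
    ≡⟨ sum-cong-≗ (λ k → sum-cong-≗ (λ i → *-distribˡ-sum (u i * A i k) (λ i′ → u i′ * A i′ k))) ⟩
  ∑[ k < n ] ∑[ i < m ] ∑[ i′ < m ] ((u i * A i k) * (u i′ * A i′ k))
    ≡⟨ ∑-comm (λ k i → ∑[ i′ < m ] ((u i * A i k) * (u i′ * A i′ k))) ⟩
  ∑[ i < m ] ∑[ k < n ] ∑[ i′ < m ] ((u i * A i k) * (u i′ * A i′ k))
    ≡⟨ sum-cong-≗ (λ i → ∑-comm (λ k i′ → (u i * A i k) * (u i′ * A i′ k))) ⟩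
  ∑[ i < m ] ∑[ i′ < m ] ∑[ k < n ] ((u i * A i k) * (u i′ * A i′ k))
    ≡⟨ sum-cong-≗ (λ i → sum-cong-≗ (regroup i)) ⟩
  ∑[ i < m ] ∑[ i′ < m ] ((u i * u i′) * dot (A i) (A i′)) ∎
  where
  open ≡-Reasoning
  interchange : ∀ a b c d → (a * b) * (c * d) ≡ (a * c) * (b * d)
  interchange = solve-∀
  regroup : ∀ i i′ → ∑[ k < n ] ((u i * A i k) * (u i′ * A i′ k)) ≡ (u i * u i′) * dot (A i) (A i′)
  regroup i i′ = begin
    ∑[ k < n ] ((u i * A i k) * (u i′ * A i′ k))
      ≡⟨ sum-cong-≗ (λ k → interchange (u i) (A i k) (u i′) (A i′ k)) ⟩
    ∑[ k < n ] ((u i * u i′) * (A i k * A i′ k))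
      ≡⟨ *-distribˡ-sum (u i * u i′) (λ k → A i k * A i′ k) ⟨
    (u i * u i′) * ∑[ k < n ] (A i k * A i′ k)
      ≡⟨ cong (λ x → (u i * u i′) * x) (sumℤ≡sum (λ k → A i k * A i′ k)) ⟨
    (u i * u i′) * dot (A i) (A i′) ∎

hadamard-parseval : ∀ {m H} → IsHadamard m H → (u : Fin m → ℤ) →
  ∑[ k < m ] ((H ᵀ· u) k * (H ᵀ· u) k) ≡ (∑[ i < m ] (u i * u i)) * + m
hadamard-parseval {m} {H} (H±1 , orthogonal) u = begin
  ∑[ k < m ] ((H ᵀ· u) k * (H ᵀ· u) k)
    ≡⟨ ∑-ᵀ·-square H u ⟩
  ∑[ i < m ] ∑[ i′ < m ] ((u i * u i′) * dot (H i) (H i′))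
    ≡⟨ sum-cong-≗ (λ i → sum-single _ i (off-diagonal i)) ⟩
  ∑[ i < m ] ((u i * u i) * dot (H i) (H i))
    ≡⟨ sum-cong-≗ (λ i → cong (λ x → (u i * u i) * x) (row-norm i)) ⟩
  ∑[ i < m ] ((u i * u i) * + m)
    ≡⟨ *-distribʳ-sum (+ m) (λ i → u i * u i) ⟨
  (∑[ i < m ] (u i * u i)) * + m ∎
  where
  open ≡-Reasoning
  off-diagonal : ∀ i i′ → i′ ≢ i → (u i * u i′) * dot (H i) (H i′) ≡ 0ℤ
  off-diagonal i i′ i′≢i =
    trans (cong (λ x → (u i * u i′) * x) (orthogonal i i′ (i′≢i ∘ sym))) (ℤ.*-zeroʳ (u i * u i′))
  row-norm : ∀ i → dot (H i) (H i) ≡ + m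
  row-norm i = trans (sumℤ≡sum (λ j → H i j * H i j)) (sum-square-units (H±1 i))

large-coefficient : ∀ {m H} → IsHadamard (suc m) H → (u : Fin (suc m) → ℤ) → (∀ i → IsUnit (u i)) →
  Σ (Fin (suc m)) λ k → + suc m ≤ (H ᵀ· u) k * (H ᵀ· u) k
large-coefficient {m} {H} isH u u±1 = k , ℤ.*-cancelˡ-≤-pos (+ M) (c k) (+ M) M*M≤M*cₖ
  where
  M : ℕ
  M = suc m
  c : Fin M → ℤ
  c k = (H ᵀ· u) k * (H ᵀ· u) k
  k : Fin M
  k = proj₁ (argmax c)
  open ℤ.≤-Reasoning
  M*M≤M*cₖ : + M * + M ≤ + M * c k
  M*M≤M*cₖ = begin
    + M * + M                        ≡⟨ cong (_* + M) (sum-square-units u±1) ⟨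
    (∑[ i < M ] (u i * u i)) * + M   ≡⟨ hadamard-parseval isH u ⟨
    ∑[ j < M ] c j                   ≤⟨ sum-mono-≤ (proj₂ (argmax c)) ⟩
    ∑[ j < M ] c k                   ≡⟨ sum-const M (c k) ⟩
    + M * c k                        ∎

IsTernary : ℤ → Set
IsTernary x = (x ≡ + 0) ⊎ ((x ≡ + 1) ⊎ (x ≡ - (+ 1)))

δ : ℤ → ℤ → ℤ
δ a x with x ℤ.≟ a
... | yes _ = 1ℤ
... | no  _ = 0ℤ

sum-δ≡countEq : ∀ {n} a (f : Fin n → ℤ) → ∑[ i < n ] δ a (f i) ≡ + countEq a f
sum-δ≡countEq {zero}  a f = refl
sum-δ≡countEq {suc n} a f with f zero ℤ.≟ a
... | yes _ = cong (λ x → 1ℤ + x) (sum-δ≡countEq a (f ∘ suc))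
... | no  _ = trans (ℤ.+-identityˡ _) (sum-δ≡countEq a (f ∘ suc))

sign₁ : ℤ → ℤ
sign₁ x with x ℤ.≟ 1ℤ
... | yes _ = 1ℤ
... | no  _ = -1ℤ

sign₁-unit : ∀ x → IsUnit (sign₁ x)
sign₁-unit x with x ℤ.≟ 1ℤ
... | yes _ = inj₁ refl
... | no  _ = inj₂ refl

weight : ℤ → ℤ
weight x = + 2 * δ -1ℤ x + -1ℤ * δ 1ℤ x

sum-weight : ∀ {n k l} (v : V n k l) → ∑[ i < n ] weight (vec v i) ≡ + 2 * + l - + k
sum-weight {n} {k} {l} (f , _ , #1≡k , #-1≡l) = begin
  ∑[ i < n ] (+ 2 * δ -1ℤ (f i) + -1ℤ * δ 1ℤ (f i))
    ≡⟨ ∑-distrib-+ (λ i → + 2 * δ -1ℤ (f i)) (λ i → -1ℤ * δ 1ℤ (f i)) ⟩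
  ∑[ i < n ] (+ 2 * δ -1ℤ (f i)) + ∑[ i < n ] (-1ℤ * δ 1ℤ (f i))
    ≡⟨ cong₂ _+_ (*-distribˡ-sum (+ 2) (δ -1ℤ ∘ f)) (*-distribˡ-sum -1ℤ (δ 1ℤ ∘ f)) ⟨
  + 2 * ∑[ i < n ] δ -1ℤ (f i) + -1ℤ * ∑[ i < n ] δ 1ℤ (f i)
    ≡⟨ cong₂ (λ a b → + 2 * a + -1ℤ * b) (sum-δ≡countEq -1ℤ f) (sum-δ≡countEq 1ℤ f) ⟩
  + 2 * + countEq -1ℤ f + -1ℤ * + countEq 1ℤ f
    ≡⟨ cong₂ (λ a b → + 2 * + a + -1ℤ * + b) #-1≡l #1≡k ⟩
  + 2 * + l + -1ℤ * + k
    ≡⟨ cong (λ x → + 2 * + l + x) (ℤ.-1*i≡-i (+ k)) ⟩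
  + 2 * + l - + k ∎
  where open ≡-Reasoning

ternary-agreement-bound : ∀ {x y} → IsTernary x → IsTernary y →
  1ℤ + sign₁ x * sign₁ y ≤ + 2 * (1ℤ + weight x + weight y) + + 4 * (x * y)
ternary-agreement-bound (inj₁ refl)        (inj₁ refl)        = decide-≤
ternary-agreement-bound (inj₁ refl)        (inj₂ (inj₁ refl)) = decide-≤
ternary-agreement-bound (inj₁ refl)        (inj₂ (inj₂ refl)) = decide-≤
ternary-agreement-bound (inj₂ (inj₁ refl)) (inj₁ refl)        = decide-≤
ternary-agreement-bound (inj₂ (inj₁ refl)) (inj₂ (inj₁ refl)) = decide-≤
ternary-agreement-bound (inj₂ (inj₁ refl)) (inj₂ (inj₂ refl)) = decide-≤
ternary-agreement-bound (inj₂ (inj₂ refl)) (inj₁ refl)        = decide-≤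
ternary-agreement-bound (inj₂ (inj₂ refl)) (inj₂ (inj₁ refl)) = decide-≤
ternary-agreement-bound (inj₂ (inj₂ refl)) (inj₂ (inj₂ refl)) = decide-≤

agreement-bound : ∀ {n k l} (v w : V n k l) →
  ∑[ j < n ] (1ℤ + sign₁ (vec v j) * sign₁ (vec w j))
    ≤ + 2 * (+ n + (+ 2 * + l - + k) + (+ 2 * + l - + k)) + + 4 * dot (vec v) (vec w)
agreement-bound {n} {k} {l} v@(f , f-ternary , _) w@(g , g-ternary , _) = begin
  ∑[ j < n ] (1ℤ + sign₁ (f j) * sign₁ (g j))
    ≤⟨ sum-mono-≤ (λ j → ternary-agreement-bound (f-ternary j) (g-ternary j)) ⟩
  ∑[ j < n ] (+ 2 * (1ℤ + weight (f j) + weight (g j)) + + 4 * (f j * g j))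
    ≡⟨ ∑-distrib-+ (λ j → + 2 * (1ℤ + weight (f j) + weight (g j))) (λ j → + 4 * (f j * g j)) ⟩
  ∑[ j < n ] (+ 2 * (1ℤ + weight (f j) + weight (g j))) + ∑[ j < n ] (+ 4 * (f j * g j))
    ≡⟨ cong₂ _+_ (*-distribˡ-sum (+ 2) (λ j → 1ℤ + weight (f j) + weight (g j)))
                 (*-distribˡ-sum (+ 4) (λ j → f j * g j)) ⟨
  + 2 * ∑[ j < n ] (1ℤ + weight (f j) + weight (g j)) + + 4 * ∑[ j < n ] (f j * g j)
    ≡⟨ cong₂ (λ a b → + 2 * a + + 4 * b) sum-of-weights (sym (sumℤ≡sum (λ j → f j * g j))) ⟩
  + 2 * (+ n + (+ 2 * + l - + k) + (+ 2 * + l - + k)) + + 4 * dot f g ∎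
  where
  open ℤ.≤-Reasoning
  sum-of-weights :
    ∑[ j < n ] (1ℤ + weight (f j) + weight (g j)) ≡ + n + (+ 2 * + l - + k) + (+ 2 * + l - + k)
  sum-of-weights = begin-equality
    ∑[ j < n ] (1ℤ + weight (f j) + weight (g j))
      ≡⟨ ∑-distrib-+ (λ j → 1ℤ + weight (f j)) (λ j → weight (g j)) ⟩
    ∑[ j < n ] (1ℤ + weight (f j)) + ∑[ j < n ] weight (g j)
      ≡⟨ cong (λ a → a + ∑[ j < n ] weight (g j)) (∑-distrib-+ (λ _ → 1ℤ) (λ j → weight (f j))) ⟩
    ∑[ j < n ] 1ℤ + ∑[ j < n ] weight (f j) + ∑[ j < n ] weight (g j)
      ≡⟨ cong₂ (λ a b → a + b + ∑[ j < n ] weight (g j)) (sum-const n 1ℤ) (sum-weight v) ⟩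
    + n * 1ℤ + (+ 2 * + l - + k) + ∑[ j < n ] weight (g j)
      ≡⟨ cong₂ (λ a b → a + (+ 2 * + l - + k) + b) (ℤ.*-identityʳ (+ n)) (sum-weight w) ⟩
    + n + (+ 2 * + l - + k) + (+ 2 * + l - + k) ∎

agreement-bound-arithmetic : ∀ {n k l : ℕ} {t s D : ℤ} → + 2 * (+ k + + l + t) ≡ + n →
  D < - (+ 2 * + l) + s →
  + 2 * (+ n + (+ 2 * + l - + k) + (+ 2 * + l - + k)) + + 4 * D ≤ + 4 * (s + + 2 * + l + t)
agreement-bound-arithmetic {n} {k} {l} {t} {s} {D} n≡ D<σ =
  ≤-from-difference (+ 4 * slack) 0≤4*slack (trans (expand (+ k) (+ l) t s D) (cong lhs n≡))
  where
  slack : ℤ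
  slack = (- (+ 2 * + l) + s) - (1ℤ + D) + + l + 1ℤ
  lhs : ℤ → ℤ
  lhs x = + 2 * (x + (+ 2 * + l - + k) + (+ 2 * + l - + k)) + + 4 * D + + 4 * slack
  0≤4*slack : 0ℤ ≤ + 4 * slack
  0≤4*slack = ℤ.*-monoˡ-≤-nonNeg (+ 4)
    (ℤ.+-mono-≤ (ℤ.+-mono-≤ (ℤ.i≤j⇒0≤j-i (ℤ.i<j⇒suc[i]≤j D<σ)) (+≤+ ℕ.z≤n)) (+≤+ ℕ.z≤n))
  expand : ∀ k l t s D → + 4 * (s + + 2 * l + t)
    ≡ + 2 * (+ 2 * (k + l + t) + (+ 2 * l - k) + (+ 2 * l - k)) + + 4 * D
      + + 4 * ((- (+ 2 * l) + s) - (1ℤ + D) + l + 1ℤ)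
  expand = solve-∀

module HadamardColouring {m r : ℕ} {H : Fin (suc m) → Fin (suc m) → ℤ} (isH : IsHadamard (suc m) H)
  where

  M : ℕ
  M = suc m

  n : ℕ
  n = M ℕ.+ r

  signs : (Fin n → ℤ) → Fin M → ℤ
  signs f j = sign₁ (f (j ↑ˡ r))

  signs-unit : ∀ f j → IsUnit (signs f j)
  signs-unit f j = sign₁-unit (f (j ↑ˡ r))

  signedCoefficient : (Fin n → ℤ) → Fin 2 → Fin M → ℤ
  signedCoefficient f ε i = signOf ε * (H ᵀ· signs f) i

  Large : (Fin n → ℤ) → Fin 2 → Fin M → Set
  Large f ε i = 0ℤ ≤ signedCoefficient f ε i
              × + M ≤ signedCoefficient f ε i * signedCoefficient f ε i

  leading : (Fin n → ℤ) → Fin M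
  leading f = proj₁ (large-coefficient isH (signs f) (signs-unit f))

  leadingSign : (Fin n → ℤ) → Fin 2
  leadingSign f = signIndex ((H ᵀ· signs f) (leading f))

  large-leading : ∀ f → Large f (leadingSign f) (leading f)
  large-leading f = signIndex-nonNeg aᵢ
                  , subst (+ M ≤_) (sym (unit-*-square aᵢ (signOf-unit (leadingSign f))))
                          (proj₂ (large-coefficient isH (signs f) (signs-unit f)))
    where
    aᵢ : ℤ
    aᵢ = (H ᵀ· signs f) (leading f)

  agreement : (Fin n → ℤ) → (Fin n → ℤ) → ℤ
  agreement f g = ∑[ j < M ] (1ℤ + signs f j * signs g j)

  large-pair-agreement : ∀ {f g ε i} → Large f ε i → Large g ε i →
    + 4 * + M ≤ agreement f g * agreement f g
  large-pair-agreement {f} {g} {ε} {i} (0≤x , M≤x²) (0≤y , M≤y²) =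
    min-square-bound 0≤x 0≤y M≤x² M≤y² (unit-inner-products-bound (signOf-unit ε) (λ j → proj₁ isH j i) (signs-unit f) (signs-unit g))

  colour : ∀ {k l} → V n k l → Fin (2 ℕ.* M)
  colour v = combine (leadingSign (vec v)) (leading (vec v))

  same-colour-agreement : ∀ {k l} (v w : V n k l) → colour v ≡ colour w →
    + 4 * + M ≤ agreement (vec v) (vec w) * agreement (vec v) (vec w)
  same-colour-agreement (f , _) (g , _) same-colour
    with Fin.combine-injective (leadingSign f) (leading f) (leadingSign g) (leading g) same-colour
  ... | same-sign , same-leading = large-pair-agreement {f} {g} {leadingSign f} {leading f} (large-leading f)
    (subst₂ (Large g) (sym same-sign) (sym same-leading) (large-leading g))

  agreement≤ : ∀ {k l} (v w : V n k l) → agreement (vec v) (vec w)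
    ≤ + 2 * (+ n + (+ 2 * + l - + k) + (+ 2 * + l - + k)) + + 4 * dot (vec v) (vec w)
  agreement≤ v w = ℤ.≤-trans
    (sum-↑ˡ-≤ M (λ j → unit-agreement-nonNeg (sign₁-unit (vec v j)) (sign₁-unit (vec w j))))
    (agreement-bound v w)

  colour-proper : ∀ {k l} {t s : ℤ} → + 2 * (+ k + + l + t) ≡ + n →
    + 4 * ((s + + 2 * + l + t) * (s + + 2 * + l + t)) < + M →
    ∀ (v w : V n k l) → Adj (- (+ 2 * + l) + s) v w → colour v ≢ colour w
  colour-proper {k} {l} {t} {s} n≡ 4Y²<M v w (_ , D<σ) same-colour = ℤ.<-irrefl refl (begin-strict
    + 4 * + M               ≤⟨ same-colour-agreement v w same-colour ⟩
    A * A                   ≤⟨ square-mono-≤ 0≤A A≤4Y ⟩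
    (+ 4 * Y) * (+ 4 * Y)   ≡⟨ regroup Y ⟩
    + 4 * (+ 4 * (Y * Y))   <⟨ ℤ.*-monoˡ-<-pos (+ 4) 4Y²<M ⟩
    + 4 * + M               ∎)
    where
    open ℤ.≤-Reasoning
    Y : ℤ
    Y = s + + 2 * + l + t
    A : ℤ
    A = agreement (vec v) (vec w)
    0≤A : 0ℤ ≤ A
    0≤A = sum-nonNeg (λ j → unit-agreement-nonNeg (signs-unit (vec v) j) (signs-unit (vec w) j))
    A≤4Y : A ≤ + 4 * Y
    A≤4Y = ℤ.≤-trans (agreement≤ v w) (agreement-bound-arithmetic {k = k} {l} {t} {s} n≡ D<σ)
    regroup : ∀ Y → (+ 4 * Y) * (+ 4 * Y) ≡ + 4 * (+ 4 * (Y * Y))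
    regroup = solve-∀

hadamard-colouring : ∀ {m r H} → IsHadamard (suc m) H → ∀ {k l} {t s : ℤ} →
  + 2 * (+ k + + l + t) ≡ + (suc m ℕ.+ r) →
  + 4 * ((s + + 2 * + l + t) * (s + + 2 * + l + t)) < + suc m →
  χ≤ (suc m ℕ.+ r) k l (- (+ 2 * + l) + s) (2 ℕ.* suc m)
hadamard-colouring isH {k} {l} {t} {s} n≡ 4Y²<M = colour , colour-proper {k} {l} {t} {s} n≡ 4Y²<M
  where open HadamardColouring isH

corollary1 : (n l m : ℕ) (t s : ℤ) (k : ℕ)
    → + 2 * (+ k + + l + t) ≡ + n
    → + m ≤ + n
    → + 4 * ((s + + 2 * + l + t) * (s + + 2 * + l + t)) < + m
    → HadamardExists m
    → χ≤ n k l (- (+ 2 * + l) + s) (2 Data.Nat.* m)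
corollary1 n l zero t s k _ _ 4Y²<0 _ =
  ⊥-elim (ℤ.<⇒≱ 4Y²<0 (ℤ.*-monoˡ-≤-nonNeg (+ 4) (square-nonNeg (s + + 2 * + l + t))))
corollary1 n l (suc m) t s k n≡ (+≤+ m≤n) 4Y²<M (H , isH) with ℕ.m≤n⇒∃[o]m+o≡n m≤n
... | r , refl = hadamard-colouring isH n≡ 4Y²<M
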